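{- For all positive integers $k,t,s$, we have $M(k,t,s)\le s^{4kt}$.
   Context: A copy of $K_s$ in an edge-colored complete graph is called rainbow if all of its $\binom{s}{2}$ edges receive distinct colors, and a copy of $K_t$ is monochromatic if all of its edges receive the same color. $M(k,t,s)$ denotes the minimum positive integer $n$ such that every edge-coloring of $K_n$ with $k$ colors contains a monochromatic $K_t$ or a rainbow $K_s$. -}

module Defs where

open import Data.Nat using (ℕ; _≤_; _^_; _*_)
open import Data.Fin using (Fin)
open import Data.Product using (Σ; _×_; ∃)
open import Data.Sum using (_⊎_)
open import Relation.Binary.PropositionalEquality using (_≡_; _≢_)
open import Function.Definitions using (Injective)

-- An edge-colouring of the complete graph K_n on vertex set Fin n with
-- colours from Fin k: a function on ordered pairs that is symmetric, so that
-- it is really a function on edges {i,j} (i ≢ j); values on the diagonal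
-- are irrelevant.
record Coloring (n k : ℕ) : Set where
  field
    col : Fin n → Fin n → Fin k
    sym : ∀ i j → col i j ≡ col j i
open Coloring public

MonoK : ∀ {n k} → Coloring n k → ℕ → Set
MonoK {n} {k} c t =
  Σ (Fin t → Fin n) λ f → Injective _≡_ _≡_ f ×
    Σ (Fin k) λ a → ∀ i j → i ≢ j → col c (f i) (f j) ≡ a

RainbowK : ∀ {n k} → Coloring n k → ℕ → Set
RainbowK {n} c s =
  Σ (Fin s → Fin n) λ f → Injective _≡_ _≡_ f ×
    (∀ i j i' j' → i ≢ j → i' ≢ j' →
       col c (f i) (f j) ≡ col c (f i') (f j') →
       (i ≡ i' × j ≡ j') ⊎ (i ≡ j' × j ≡ i'))

Arrows : ℕ → ℕ → ℕ → ℕ → Set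
Arrows k t s n = (c : Coloring n k) → MonoK c t ⊎ RainbowK c s

-- M(k,t,s) ≤ N  iff  some positive n ≤ N has the property
-- (the minimum positive such n then exists and is ≤ N)
M≤ : ℕ → ℕ → ℕ → ℕ → Set
M≤ k t s N = Σ ℕ λ n → 1 ≤ n × n ≤ N × Arrows k t s n

module Submission where

-- Keep a set S of candidate vertices and, for every colour a, a clique L a of colour a whose
-- vertices see all of S in colour a.  If some v ∈ S has at least |S|/s⁴ neighbours of one
-- colour a inside S, put v into L a and shrink S to those neighbours; since each L a stays
-- below t, this happens fewer than k t times, which s^(4kt) vertices can afford.  Otherwise
-- all colour classes inside S have size D < |S|/s⁴ and a rainbow K_s is built greedily: each
-- new vertex r spoils at most 1 + 2s²D candidates, where the only spoiling condition not
-- controlled by class sizes, c(r,u) = c(p,u), is made rare by choosing r by averaging.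

open import Defs renaming (sym to col-sym)
open import Algebra.Properties.CommutativeSemigroup using (interchange; x∙yz≈y∙xz)
open import Data.Empty using (⊥-elim)
open import Data.Fin using (Fin; inject≤)
import Data.Fin.Properties as Fin
open import Data.Fin.Properties using (_≟_; inject≤-injective)
open import Data.List using (List; []; _∷_; length; filter; map; lookup; allFin)
open import Data.List.Properties using (filter-≐; filter-none; map-cong; length-tabulate)
open import Data.List.Membership.Propositional using (_∈_; _∉_; find; lose)
open import Data.List.Membership.Propositional.Properties using (∈-lookup; ∈-filter⁻)
open import Data.List.Relation.Binary.Sublist.Propositional as Sublist using (_⊆_; ⊆-refl; ⊆-trans)
open import Data.List.Relation.Binary.Sublist.Propositional.Properties using (filter⁺; filter-⊆; length-mono-≤)
open import Data.List.Relation.Unary.All as All using (All; []; _∷_)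
open import Data.List.Relation.Unary.AllPairs using ([]; _∷_)
open import Data.List.Relation.Unary.Any using (Any; here; there; any?)
open import Data.List.Relation.Unary.Unique.Propositional using (Unique)
import Data.List.Relation.Unary.Unique.Propositional.Properties as Unique
open import Data.Nat using (ℕ; zero; suc; _+_; _*_; _^_; _≤_; _<_; z≤n; s≤s; pred; NonZero; >-nonZero)
open import Data.Nat.ListAction using (sum)
open import Data.Nat.Properties hiding (_≟_; suc-injective)
open import Data.Nat.Tactic.RingSolver using (solve-∀)
open import Data.Product using (Σ; _×_; _,_; proj₁; proj₂)
open import Data.Sum using (_⊎_; inj₁; inj₂)
open import Data.Vec.Functional using (updateAt)
open import Data.Vec.Functional.Properties using (updateAt-updates; updateAt-minimal)
open import Function using (_∘_)
open import Function.Definitions using (Injective)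
open import Relation.Nullary using (¬_; Dec; yes; no)
open import Relation.Nullary.Decidable using (¬?; _×-dec_; _⊎-dec_)
open import Relation.Unary using (Decidable)
open import Relation.Unary.Properties using (∁?)
open import Relation.Binary.PropositionalEquality using (_≡_; _≢_; refl; sym; trans; cong; subst; module ≡-Reasoning)

-- Counting in lists

private
  variable
    A B : Set

count : {P : A → Set} → Decidable P → List A → ℕ
count P? xs = length (filter P? xs)

module _ {P : A → Set} (P? : Decidable P) where

  count-⊆ : ∀ {xs ys} → xs ⊆ ys → count P? xs ≤ count P? ys
  count-⊆ τ = length-mono-≤ (filter⁺ P? P? (λ { refl p → p }) τ)

  count+count-∁ : ∀ xs → count P? xs + count (∁? P?) xs ≡ length xs
  count+count-∁ [] = refl
  count+count-∁ (x ∷ xs) with P? x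
  ... | yes _ = cong suc (count+count-∁ xs)
  ... | no _ = trans (+-suc _ _) (cong suc (count+count-∁ xs))

  count-≡-sum : ∀ xs → count P? xs ≡ sum (map (λ x → count P? (x ∷ [])) xs)
  count-≡-sum [] = refl
  count-≡-sum (x ∷ xs) with P? x
  ... | yes _ = cong suc (count-≡-sum xs)
  ... | no _ = count-≡-sum xs

module _ {P Q : A → Set} (P? : Decidable P) (Q? : Decidable Q) where

  count-mono : (∀ {x} → P x → Q x) → ∀ xs → count P? xs ≤ count Q? xs
  count-mono P⊆Q [] = z≤n
  count-mono P⊆Q (x ∷ xs) with P? x | Q? x
  ... | yes _  | yes _ = s≤s (count-mono P⊆Q xs)
  ... | yes px | no ¬qx = ⊥-elim (¬qx (P⊆Q px))
  ... | no _   | yes _ = m≤n⇒m≤1+n (count-mono P⊆Q xs)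
  ... | no _   | no _  = count-mono P⊆Q xs

  count-∪ : ∀ xs → count (λ x → P? x ⊎-dec Q? x) xs ≤ count P? xs + count Q? xs
  count-∪ [] = z≤n
  count-∪ (x ∷ xs) with P? x | Q? x
  ... | yes _ | yes _ = s≤s (≤-trans (count-∪ xs) (+-monoʳ-≤ (count P? xs) (n≤1+n _)))
  ... | yes _ | no _  = s≤s (count-∪ xs)
  ... | no _  | yes _ = ≤-trans (s≤s (count-∪ xs)) (≤-reflexive (sym (+-suc _ _)))
  ... | no _  | no _  = count-∪ xs

count-cong : {P Q : A → Set} (P? : Decidable P) (Q? : Decidable Q) →
  (∀ {x} → P x → Q x) → (∀ {x} → Q x → P x) → ∀ xs → count P? xs ≡ count Q? xs
count-cong P? Q? P⇒Q Q⇒P xs = cong length (filter-≐ P? Q? (P⇒Q , Q⇒P) xs)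

count-≡-Unique : (_≟_ : (x y : A) → Dec (x ≡ y)) → ∀ r {xs} → Unique xs → count (_≟ r) xs ≤ 1
count-≡-Unique _≟_ r {[]} _ = z≤n
count-≡-Unique _≟_ r {x ∷ xs} (x∉xs ∷ uxs) with x ≟ r
... | yes refl = s≤s (≤-reflexive (none xs x∉xs))
  where
  none : ∀ ys → All (λ y → ¬ x ≡ y) ys → count (_≟ x) ys ≡ 0
  none [] [] = refl
  none (y ∷ ys) (x≢y ∷ x∉ys) with y ≟ x
  ... | yes y≡x = ⊥-elim (x≢y (sym y≡x))
  ... | no _ = none ys x∉ys
... | no _ = count-≡-Unique _≟_ r uxs

sum-map-≤ : (f : A → ℕ) {D : ℕ} → ∀ xs → (∀ {x} → x ∈ xs → f x ≤ D) → sum (map f xs) ≤ length xs * D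
sum-map-≤ f [] _ = z≤n
sum-map-≤ f (x ∷ xs) f≤D = +-mono-≤ (f≤D (here refl)) (sum-map-≤ f xs (λ x∈xs → f≤D (there x∈xs)))

sum-map-+ : (f g : A → ℕ) → ∀ xs → sum (map (λ x → f x + g x) xs) ≡ sum (map f xs) + sum (map g xs)
sum-map-+ f g [] = refl
sum-map-+ f g (x ∷ xs) =
  trans (cong (f x + g x +_) (sum-map-+ f g xs)) (interchange +-commutativeSemigroup (f x) (g x) _ _)

sum-map-0 : ∀ (xs : List A) → sum (map (λ _ → 0) xs) ≡ 0
sum-map-0 [] = refl
sum-map-0 (x ∷ xs) = sum-map-0 xs

sum-map-comm : (f : A → B → ℕ) → ∀ xs ys →
  sum (map (λ x → sum (map (f x) ys)) xs) ≡ sum (map (λ y → sum (map (λ x → f x y) xs)) ys)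
sum-map-comm f [] ys = sym (sum-map-0 ys)
sum-map-comm f (x ∷ xs) ys rewrite sum-map-comm f xs ys =
  sym (sum-map-+ (f x) (λ y → sum (map (λ x → f x y) xs)) ys)

count-double : {R : A → B → Set} (R? : ∀ x → Decidable (R x)) → ∀ xs ys →
  sum (map (λ x → count (R? x) ys) xs) ≡ sum (map (λ y → count (λ x → R? x y) xs) ys)
count-double R? xs ys = begin
  sum (map (λ x → count (R? x) ys) xs)
    ≡⟨ cong sum (map-cong (λ x → count-≡-sum (R? x) ys) xs) ⟩
  sum (map (λ x → sum (map (λ y → count (R? x) (y ∷ [])) ys)) xs)
    ≡⟨ sum-map-comm (λ x y → count (R? x) (y ∷ [])) xs ys ⟩
  sum (map (λ y → sum (map (λ x → count (R? x) (y ∷ [])) xs)) ys)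
    ≡⟨ cong sum (map-cong (λ y → cong sum (map-cong (λ x → singleton-swap x y) xs)) ys) ⟩
  sum (map (λ y → sum (map (λ x → count (λ x → R? x y) (x ∷ [])) xs)) ys)
    ≡⟨ cong sum (map-cong (λ y → sym (count-≡-sum (λ x → R? x y) xs)) ys) ⟩
  sum (map (λ y → count (λ x → R? x y) xs) ys) ∎
  where
  open ≡-Reasoning
  singleton-swap : ∀ x y → count (R? x) (y ∷ []) ≡ count (λ x → R? x y) (x ∷ [])
  singleton-swap x y with R? x y
  ... | yes _ = refl
  ... | no _ = refl

count-Any : {R : B → A → Set} (R? : ∀ z → Decidable (R z)) → ∀ zs xs →
  count (λ x → any? (λ z → R? z x) zs) xs ≤ sum (map (λ z → count (R? z) xs) zs)
count-Any R? [] xs =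
  ≤-reflexive (cong length (filter-none (λ x → any? (λ z → R? z x) []) (All.universal (λ _ ()) xs)))
count-Any R? (z ∷ zs) xs = begin
  count (λ x → any? (λ z → R? z x) (z ∷ zs)) xs
    ≤⟨ count-mono (λ x → any? (λ z → R? z x) (z ∷ zs)) (λ x → R? z x ⊎-dec any? (λ z → R? z x) zs)
         (λ { (here p) → inj₁ p ; (there p) → inj₂ p }) xs ⟩
  count (λ x → R? z x ⊎-dec any? (λ z → R? z x) zs) xs
    ≤⟨ count-∪ (R? z) (λ x → any? (λ z → R? z x) zs) xs ⟩
  count (R? z) xs + count (λ x → any? (λ z → R? z x) zs) xs
    ≤⟨ +-monoʳ-≤ (count (R? z) xs) (count-Any R? zs xs) ⟩
  count (R? z) xs + sum (map (λ z → count (R? z) xs) zs) ∎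
  where open ≤-Reasoning

count-Any-≤ : {R : B → A → Set} (R? : ∀ z → Decidable (R z)) {D : ℕ} → ∀ zs xs →
  (∀ {z} → z ∈ zs → count (R? z) xs ≤ D) → count (λ x → any? (λ z → R? z x) zs) xs ≤ length zs * D
count-Any-≤ R? zs xs bound = ≤-trans (count-Any R? zs xs) (sum-map-≤ (λ z → count (R? z) xs) zs bound)

sum<⇒∃≤ : (f : A → ℕ) (M : ℕ) → ∀ xs → sum (map f xs) < length xs * suc M → Σ A λ x → x ∈ xs × f x ≤ M
sum<⇒∃≤ f M (x ∷ xs) sum< with f x ≤? M
... | yes fx≤M = x , here refl , fx≤M
... | no fx≰M =
  let (y , y∈xs , fy≤M) = sum<⇒∃≤ f M xs
        (+-cancelˡ-< (suc M) _ _ (≤-trans (+-monoˡ-≤ _ (s≤s (≰⇒> fx≰M))) sum<))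
  in y , there y∈xs , fy≤M

lookup-injective : {xs : List A} → Unique xs → Injective _≡_ _≡_ (lookup xs)
lookup-injective {xs = x ∷ xs} _ {Fin.zero} {Fin.zero} _ = refl
lookup-injective {xs = x ∷ xs} (x∉xs ∷ _) {Fin.zero} {Fin.suc j} x≡ = ⊥-elim (All.lookup x∉xs (∈-lookup j) x≡)
lookup-injective {xs = x ∷ xs} (x∉xs ∷ _) {Fin.suc i} {Fin.zero} ≡x = ⊥-elim (All.lookup x∉xs (∈-lookup i) (sym ≡x))
lookup-injective {xs = x ∷ xs} (_ ∷ xs-unique) {Fin.suc i} {Fin.suc j} eq = cong Fin.suc (lookup-injective xs-unique eq)

module _ {xs : List A} (xs-unique : Unique xs) {t : ℕ} (t≤ : t ≤ length xs) where

  select : Fin t → A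
  select i = lookup xs (inject≤ i t≤)

  select-injective : Injective _≡_ _≡_ select
  select-injective {i} {j} eq = inject≤-injective t≤ t≤ i j (lookup-injective xs-unique eq)

  select-∈ : ∀ i → select i ∈ xs
  select-∈ i = ∈-lookup (inject≤ i t≤)

∑ : ∀ {k} → (Fin k → ℕ) → ℕ
∑ {zero} f = 0
∑ {suc k} f = f Fin.zero + ∑ (f ∘ Fin.suc)

∑-zero : ∀ k → ∑ {k} (λ _ → 0) ≡ 0
∑-zero zero = refl
∑-zero (suc k) = ∑-zero k

∑-<-bound : ∀ {k t} (f : Fin k → ℕ) → (∀ a → f a < t) → ∑ f + k ≤ k * t
∑-<-bound {zero} f _ = z≤n
∑-<-bound {suc k} {t} f f<t = begin
  f Fin.zero + ∑ (f ∘ Fin.suc) + suc k     ≡⟨ +-suc (f Fin.zero + ∑ (f ∘ Fin.suc)) k ⟩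
  suc (f Fin.zero + ∑ (f ∘ Fin.suc) + k)   ≡⟨ cong suc (+-assoc (f Fin.zero) _ k) ⟩
  suc (f Fin.zero) + (∑ (f ∘ Fin.suc) + k) ≤⟨ +-mono-≤ (f<t Fin.zero) (∑-<-bound (f ∘ Fin.suc) (f<t ∘ Fin.suc)) ⟩
  t + k * t ∎
  where open ≤-Reasoning

∑-updateAt-∷ : ∀ {k} (L : Fin k → List A) a x → ∑ (length ∘ updateAt L a (x ∷_)) ≡ suc (∑ (length ∘ L))
∑-updateAt-∷ {k = suc k} L Fin.zero x = refl
∑-updateAt-∷ {k = suc k} L (Fin.suc a) x =
  trans (cong (length (L Fin.zero) +_) (∑-updateAt-∷ (L ∘ Fin.suc) a x)) (+-suc _ _)

updateAt-elim : ∀ {m} (P : Fin m → A → Set) (xs : Fin m → A) a (f : A → A) →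
  P a (f (xs a)) → (∀ b → b ≢ a → P b (xs b)) → ∀ b → P b (updateAt xs a f b)
updateAt-elim P xs a f Pa Pb b with b ≟ a
... | yes refl = subst (P a) (sym (updateAt-updates a xs)) Pa
... | no b≢a = subst (P b) (sym (updateAt-minimal b a xs b≢a)) (Pb b b≢a)

spoiled-≤ : ∀ {j s} D → suc j ≤ s → j * D + (suc j * (suc j * D) + j * (j * D)) ≤ 2 * (s * s) * D
spoiled-≤ {j} {s} D j<s = m+n≤o⇒m≤o _ (begin
  j * D + (suc j * (suc j * D) + j * (j * D)) + suc j * D ≡⟨ identity j D ⟩
  2 * (suc j * suc j) * D                                ≤⟨ *-monoˡ-≤ D (*-monoʳ-≤ 2 (*-mono-≤ j<s j<s)) ⟩
  2 * (s * s) * D ∎)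
  where
  open ≤-Reasoning
  identity : ∀ j D → j * D + (suc j * (suc j * D) + j * (j * D)) + suc j * D ≡ 2 * (suc j * suc j) * D
  identity = solve-∀

rainbow-threshold-≤ : ∀ {s} D → 2 ≤ s → s * (1 + 2 * (s * s) * D) ≤ s ^ 4 * suc D
rainbow-threshold-≤ {s@(suc _)} D 2≤s = begin
  s * (1 + 2 * (s * s) * D)              ≡⟨ lhs s D ⟩
  s + 2 * (s * s * s * D)                ≤⟨ +-mono-≤ (m≤m*n s (s * s * s)) (*-monoˡ-≤ (s * s * s * D) 2≤s) ⟩
  s * (s * s * s) + s * (s * s * s * D)  ≡⟨ rhs s D ⟩
  s ^ 4 * suc D ∎
  where
  open ≤-Reasoning
  lhs : ∀ s D → s * (1 + 2 * (s * s) * D) ≡ s + 2 * (s * s * s * D)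
  lhs = solve-∀
  -- s ^ 4 unfolded by hand: solve-∀ does not reflect _^_.
  rhs : ∀ s D → s * (s * s * s) + s * (s * s * s * D) ≡ s * (s * (s * (s * 1))) * (1 + D)
  rhs = solve-∀

module _ {n k : ℕ} (c : Coloring n k) where

  InClass : Fin n → Fin k → Fin n → Set
  InClass v a u = u ≢ v × col c v u ≡ a

  inClass? : ∀ v a → Decidable (InClass v a)
  inClass? v a u = ¬? (u ≟ v) ×-dec (col c v u ≟ a)

  neighbours : Fin n → Fin k → List (Fin n) → List (Fin n)
  neighbours v a = filter (inClass? v a)

  IsMonochromatic : Fin k → List (Fin n) → Set
  IsMonochromatic a K = ∀ {x y} → x ∈ K → y ∈ K → x ≢ y → col c x y ≡ a

  IsRainbow : List (Fin n) → Set
  IsRainbow R = ∀ {x y x′ y′} → x ∈ R → y ∈ R → x′ ∈ R → y′ ∈ R → x ≢ y → x′ ≢ y′ →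
    col c x y ≡ col c x′ y′ → (x ≡ x′ × y ≡ y′) ⊎ (x ≡ y′ × y ≡ x′)

  Extends : List (Fin n) → Fin n → Set
  Extends R u = (∀ {p q} → p ∈ R → q ∈ R → p ≢ q → col c p u ≢ col c q u) ×
                (∀ {p x y} → p ∈ R → x ∈ R → y ∈ R → x ≢ y → col c p u ≢ col c x y)

  ∷-isRainbow : ∀ {R u} → IsRainbow R → Extends R u → IsRainbow (u ∷ R)
  ∷-isRainbow R-rainbow _ (there x) (there y) (there x′) (there y′) x≢y x′≢y′ eq =
    R-rainbow x y x′ y′ x≢y x′≢y′ eq
  ∷-isRainbow _ _ (here refl) (here refl) _ _ x≢y _ _ = ⊥-elim (x≢y refl)
  ∷-isRainbow _ _ _ _ (here refl) (here refl) _ x′≢y′ _ = ⊥-elim (x′≢y′ refl)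
  ∷-isRainbow {u = u} _ (distinct , _) {y = y} {y′ = y′} (here refl) (there y∈) (here refl) (there y′∈) _ _ eq
    with y ≟ y′
  ... | yes y≡y′ = inj₁ (refl , y≡y′)
  ... | no y≢y′ = ⊥-elim (distinct y∈ y′∈ y≢y′ (trans (col-sym c y u) (trans eq (col-sym c u y′))))
  ∷-isRainbow {u = u} _ (distinct , _) {y = y} {x′ = x′} (here refl) (there y∈) (there x′∈) (here refl) _ _ eq
    with y ≟ x′
  ... | yes y≡x′ = inj₂ (refl , y≡x′)
  ... | no y≢x′ = ⊥-elim (distinct y∈ x′∈ y≢x′ (trans (col-sym c y u) eq))
  ∷-isRainbow {u = u} _ (_ , new) {y = y} (here refl) (there y∈) (there x′∈) (there y′∈) _ x′≢y′ eq =
    ⊥-elim (new y∈ x′∈ y′∈ x′≢y′ (trans (col-sym c y u) eq))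
  ∷-isRainbow {u = u} _ (distinct , _) {x = x} {y′ = y′} (there x∈) (here refl) (here refl) (there y′∈) _ _ eq
    with x ≟ y′
  ... | yes x≡y′ = inj₂ (x≡y′ , refl)
  ... | no x≢y′ = ⊥-elim (distinct x∈ y′∈ x≢y′ (trans eq (col-sym c u y′)))
  ∷-isRainbow _ (distinct , _) {x = x} {x′ = x′} (there x∈) (here refl) (there x′∈) (here refl) _ _ eq
    with x ≟ x′
  ... | yes x≡x′ = inj₁ (x≡x′ , refl)
  ... | no x≢x′ = ⊥-elim (distinct x∈ x′∈ x≢x′ eq)
  ∷-isRainbow _ (_ , new) (there x∈) (here refl) (there x′∈) (there y′∈) _ x′≢y′ eq =
    ⊥-elim (new x∈ x′∈ y′∈ x′≢y′ eq)
  ∷-isRainbow {u = u} _ (_ , new) {y′ = y′} (there x∈) (there y∈) (here refl) (there y′∈) x≢y _ eq =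
    ⊥-elim (new y′∈ x∈ y∈ x≢y (trans (col-sym c y′ u) (sym eq)))
  ∷-isRainbow _ (_ , new) (there x∈) (there y∈) (there x′∈) (here refl) x≢y _ eq =
    ⊥-elim (new x′∈ x∈ y∈ x≢y (sym eq))

  singleton-isRainbow : ∀ u → IsRainbow (u ∷ [])
  singleton-isRainbow u = ∷-isRainbow (λ ()) ((λ ()) , (λ ()))

  monoK : ∀ {t a K} → Unique K → t ≤ length K → IsMonochromatic a K → MonoK c t
  monoK {a = a} K-unique t≤ K-mono =
    select K-unique t≤ , select-injective K-unique t≤ , a ,
    λ i j i≢j → K-mono (select-∈ K-unique t≤ i) (select-∈ K-unique t≤ j) (i≢j ∘ select-injective K-unique t≤)

  rainbowK : ∀ {s R} → Unique R → length R ≡ s → IsRainbow R → RainbowK c s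
  rainbowK {R = R} R-unique refl R-rainbow = f , f-injective , rainbow
    where
    f : Fin (length R) → Fin n
    f = select R-unique ≤-refl
    f-injective : Injective _≡_ _≡_ f
    f-injective = select-injective R-unique ≤-refl
    f-∈ : ∀ i → f i ∈ R
    f-∈ = select-∈ R-unique ≤-refl
    rainbow : ∀ i j i′ j′ → i ≢ j → i′ ≢ j′ → col c (f i) (f j) ≡ col c (f i′) (f j′) →
      (i ≡ i′ × j ≡ j′) ⊎ (i ≡ j′ × j ≡ i′)
    rainbow i j i′ j′ i≢j i′≢j′ eq
      with R-rainbow (f-∈ i) (f-∈ j) (f-∈ i′) (f-∈ j′) (i≢j ∘ f-injective) (i′≢j′ ∘ f-injective) eq
    ... | inj₁ (i≡ , j≡) = inj₁ (f-injective i≡ , f-injective j≡)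
    ... | inj₂ (i≡ , j≡) = inj₂ (f-injective i≡ , f-injective j≡)

  -- Greedy rainbow cliques

  module Greedy (s D : ℕ) (S : List (Fin n))
                (class-small : ∀ {v} a → v ∈ S → count (inClass? v a) S ≤ D) where

    -- Bounds the 1 + jD + (j+1)²D + j²D candidates spoiled when the (j+1)-st vertex is chosen.
    waste : ℕ
    waste = 1 + 2 * (s * s) * D

    class-small-⊆ : ∀ {T v} a → T ⊆ S → v ∈ S → count (inClass? v a) T ≤ D
    class-small-⊆ a T⊆S v∈S = ≤-trans (count-⊆ (inClass? _ a) T⊆S) (class-small a v∈S)

    Clash : Fin n → Fin n → Fin n → Set
    Clash r p u = u ≢ r × col c r u ≡ col c p u

    clash? : ∀ r p → Decidable (Clash r p)
    clash? r p u = ¬? (u ≟ r) ×-dec (col c r u ≟ col c p u)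

    clashes : List (Fin n) → List (Fin n) → Fin n → ℕ
    clashes R T r = sum (map (λ p → count (clash? r p) T) R)

    -- Counting the clashes r ~ u through p by u instead of r turns them into neighbourhood classes of u.
    clashes-through-≤ : ∀ {T} → T ⊆ S → ∀ p → sum (map (λ r → count (clash? r p) T) T) ≤ length T * D
    clashes-through-≤ {T} T⊆S p = begin
      sum (map (λ r → count (clash? r p) T) T)
        ≡⟨ count-double (λ r → clash? r p) T T ⟩
      sum (map (λ u → count (λ r → clash? r p u) T) T)
        ≡⟨ cong sum (map-cong (λ u → count-cong (λ r → clash? r p u) (inClass? u (col c u p)) to from T) T) ⟩
      sum (map (λ u → count (inClass? u (col c u p)) T) T)
        ≤⟨ sum-map-≤ _ T (λ u∈T → class-small-⊆ _ T⊆S (Sublist.lookup T⊆S u∈T)) ⟩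
      length T * D ∎
      where
      open ≤-Reasoning
      to : ∀ {u r} → Clash r p u → InClass u (col c u p) r
      to {u} {r} (u≢r , eq) = u≢r ∘ sym , trans (col-sym c u r) (trans eq (col-sym c p u))
      from : ∀ {u r} → InClass u (col c u p) r → Clash r p u
      from {u} {r} (r≢u , eq) = r≢u ∘ sym , trans (col-sym c r u) (trans eq (col-sym c u p))

    few-clashes : ∀ {T} R → T ⊆ S → 1 ≤ length T → Σ (Fin n) λ r → r ∈ T × clashes R T r ≤ length R * D
    few-clashes {T} R T⊆S 1≤|T| = sum<⇒∃≤ (clashes R T) (length R * D) T (begin-strict
      sum (map (clashes R T) T)
        ≡⟨ sum-map-comm (λ r p → count (clash? r p) T) T R ⟩
      sum (map (λ p → sum (map (λ r → count (clash? r p) T) T)) R)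
        ≤⟨ sum-map-≤ _ R (λ _ → clashes-through-≤ T⊆S _) ⟩
      length R * (length T * D)
        ≡⟨ x∙yz≈y∙xz *-commutativeSemigroup (length R) (length T) D ⟩
      length T * (length R * D)
        <⟨ m<n+m _ 1≤|T| ⟩
      length T + length T * (length R * D)
        ≡⟨ sym (*-suc (length T) _) ⟩
      length T * suc (length R * D) ∎)
      where open ≤-Reasoning

    -- u must be discarded once r joins R: u = r, or u ∷ r ∷ R would fail to be rainbow
    -- in one of the ways not already excluded by Extends R u.
    Spoils : Fin n → List (Fin n) → Fin n → Set
    Spoils r R u =
      u ≡ r ⊎
      (Any (λ p → Clash r p u) R ⊎
      (Any (λ x → Any (λ y → InClass r (col c x y) u) (r ∷ R)) (r ∷ R) ⊎
       Any (λ p → Any (λ x → InClass p (col c r x) u) R) R))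

    spoils? : ∀ r R → Decidable (Spoils r R)
    spoils? r R u =
      u ≟ r ⊎-dec
      (any? (λ p → clash? r p u) R ⊎-dec
      (any? (λ x → any? (λ y → inClass? r (col c x y) u) (r ∷ R)) (r ∷ R) ⊎-dec
       any? (λ p → any? (λ x → inClass? p (col c r x) u) R) R))

    count-spoils-≤ : ∀ {r R T} → suc (length R) ≤ s → Unique T → T ⊆ S → r ∈ S → (∀ {p} → p ∈ R → p ∈ S) →
      clashes R T r ≤ length R * D → count (spoils? r R) T ≤ waste
    count-spoils-≤ {r} {R} {T} R<s T-unique T⊆S r∈S R⊆S few = begin
      count (spoils? r R) T
        ≤⟨ count-∪ (_≟ r) _ T ⟩
      count (_≟ r) T + count (λ u → clash-any? u ⊎-dec (new-edge? u ⊎-dec old-edge? u)) T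
        ≤⟨ +-mono-≤ (count-≡-Unique _≟_ r T-unique) (count-∪ clash-any? _ T) ⟩
      1 + (count clash-any? T + count (λ u → new-edge? u ⊎-dec old-edge? u) T)
        ≤⟨ +-monoʳ-≤ 1 (+-mono-≤ count-clash-any (count-∪ new-edge? old-edge? T)) ⟩
      1 + (j * D + (count new-edge? T + count old-edge? T))
        ≤⟨ +-monoʳ-≤ 1 (+-monoʳ-≤ (j * D) (+-mono-≤ count-new-edge count-old-edge)) ⟩
      1 + (j * D + (suc j * (suc j * D) + j * (j * D)))
        ≤⟨ +-monoʳ-≤ 1 (spoiled-≤ D R<s) ⟩
      waste ∎
      where
      open ≤-Reasoning
      j : ℕ
      j = length R
      clash-any? : Decidable (λ u → Any (λ p → Clash r p u) R)
      new-edge? : Decidable (λ u → Any (λ x → Any (λ y → InClass r (col c x y) u) (r ∷ R)) (r ∷ R))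
      old-edge? : Decidable (λ u → Any (λ p → Any (λ x → InClass p (col c r x) u) R) R)
      clash-any? u = any? (λ p → clash? r p u) R
      new-edge? u = any? (λ x → any? (λ y → inClass? r (col c x y) u) (r ∷ R)) (r ∷ R)
      old-edge? u = any? (λ p → any? (λ x → inClass? p (col c r x) u) R) R
      count-clash-any : count clash-any? T ≤ j * D
      count-clash-any = ≤-trans (count-Any (λ p u → clash? r p u) R T) few
      count-new-edge : count new-edge? T ≤ suc j * (suc j * D)
      count-new-edge = count-Any-≤ (λ x u → any? (λ y → inClass? r (col c x y) u) (r ∷ R)) (r ∷ R) T
        (λ _ → count-Any-≤ (λ y → inClass? r (col c _ y)) (r ∷ R) T (λ _ → class-small-⊆ _ T⊆S r∈S))
      count-old-edge : count old-edge? T ≤ j * (j * D)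
      count-old-edge = count-Any-≤ (λ p u → any? (λ x → inClass? p (col c r x) u) R) R T
        (λ p∈R → count-Any-≤ (λ x → inClass? _ (col c r x)) R T (λ _ → class-small-⊆ _ T⊆S (R⊆S p∈R)))

    extends-∷ : ∀ {r R u} → Extends R u → u ∉ R → ¬ Spoils r R u → Extends (r ∷ R) u
    extends-∷ {r} {R} {u} (distinct , new) u∉R fine = distinct′ , new′
      where
      u≢r : u ≢ r
      u≢r = fine ∘ inj₁
      ≢R : ∀ {p} → p ∈ R → u ≢ p
      ≢R p∈R refl = u∉R p∈R
      distinct′ : ∀ {p q} → p ∈ r ∷ R → q ∈ r ∷ R → p ≢ q → col c p u ≢ col c q u
      distinct′ (here refl) (here refl) p≢q _ = p≢q refl
      distinct′ (here refl) (there q∈R) _ eq = fine (inj₂ (inj₁ (lose q∈R (u≢r , eq))))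
      distinct′ (there p∈R) (here refl) _ eq = fine (inj₂ (inj₁ (lose p∈R (u≢r , sym eq))))
      distinct′ (there p∈R) (there q∈R) p≢q eq = distinct p∈R q∈R p≢q eq
      new′ : ∀ {p x y} → p ∈ r ∷ R → x ∈ r ∷ R → y ∈ r ∷ R → x ≢ y → col c p u ≢ col c x y
      new′ (here refl) x∈ y∈ _ eq = fine (inj₂ (inj₂ (inj₁ (lose x∈ (lose y∈ (u≢r , eq))))))
      new′ (there p∈R) (here refl) (here refl) x≢y _ = x≢y refl
      new′ (there p∈R) (here refl) (there y∈R) _ eq =
        fine (inj₂ (inj₂ (inj₂ (lose p∈R (lose y∈R (≢R p∈R , eq))))))
      new′ {x = x} (there p∈R) (there x∈R) (here refl) _ eq =
        fine (inj₂ (inj₂ (inj₂ (lose p∈R (lose x∈R (≢R p∈R , trans eq (col-sym c x r)))))))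
      new′ (there p∈R) (there x∈R) (there y∈R) x≢y eq = new p∈R x∈R y∈R x≢y eq

    record Partial (m : ℕ) : Set where
      field
        chosen candidates : List (Fin n)
        chosen-size : length chosen + m ≡ s
        candidates-size : m * waste ≤ length candidates
        chosen-unique : Unique chosen
        candidates-unique : Unique candidates
        chosen⊆S : ∀ {p} → p ∈ chosen → p ∈ S
        candidates⊆S : candidates ⊆ S
        chosen∉candidates : ∀ {p} → p ∈ chosen → p ∉ candidates
        chosen-rainbow : IsRainbow chosen
        candidates-extend : ∀ {u} → u ∈ candidates → Extends chosen u

    start : Unique S → s * waste ≤ length S → Partial s
    start S-unique s*waste≤|S| = record
      { chosen = [] ; candidates = S ; chosen-size = refl ; candidates-size = s*waste≤|S|
      ; chosen-unique = [] ; candidates-unique = S-unique ; chosen⊆S = λ () ; candidates⊆S = ⊆-refl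
      ; chosen∉candidates = λ () ; chosen-rainbow = λ () ; candidates-extend = λ _ → (λ ()) , (λ ()) }

    step : ∀ {m} → Partial (suc m) → Partial m
    step {m} P = record
      { chosen = r ∷ R ; candidates = T′
      ; chosen-size = trans (sym (+-suc j m)) chosen-size
      ; candidates-size = +-cancelˡ-≤ waste _ _ (begin
          waste + m * waste                  ≤⟨ candidates-size ⟩
          length T                           ≡⟨ sym (count+count-∁ (spoils? r R) T) ⟩
          count (spoils? r R) T + length T′  ≤⟨ +-monoˡ-≤ _ spoiled ⟩
          waste + length T′ ∎)
      ; chosen-unique = All.tabulate (λ { p∈R refl → chosen∉candidates p∈R r∈T }) ∷ chosen-unique
      ; candidates-unique = Unique.filter⁺ (∁? (spoils? r R)) candidates-unique
      ; chosen⊆S = λ { (here refl) → r∈S ; (there p∈R) → chosen⊆S p∈R }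
      ; candidates⊆S = ⊆-trans (filter-⊆ (∁? (spoils? r R)) T) candidates⊆S
      ; chosen∉candidates = λ
          { (here refl) r∈T′ → proj₂ (∈T′⁻ r∈T′) (inj₁ refl)
          ; (there p∈R) p∈T′ → chosen∉candidates p∈R (proj₁ (∈T′⁻ p∈T′)) }
      ; chosen-rainbow = ∷-isRainbow chosen-rainbow (candidates-extend r∈T)
      ; candidates-extend = λ u∈T′ →
          let (u∈T , fine) = ∈T′⁻ u∈T′
          in extends-∷ (candidates-extend u∈T) (λ u∈R → chosen∉candidates u∈R u∈T) fine
      }
      where
      open Partial P
      open ≤-Reasoning
      R T : List (Fin n)
      R = chosen
      T = candidates
      j : ℕ
      j = length R
      R<s : suc j ≤ s
      R<s = subst (suc j ≤_) chosen-size (m<m+n j (s≤s z≤n))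
      choice : Σ (Fin n) λ r → r ∈ T × clashes R T r ≤ j * D
      choice = few-clashes R candidates⊆S (≤-trans (s≤s z≤n) candidates-size)
      r : Fin n
      r = proj₁ choice
      r∈T : r ∈ T
      r∈T = proj₁ (proj₂ choice)
      few : clashes R T r ≤ j * D
      few = proj₂ (proj₂ choice)
      r∈S : r ∈ S
      r∈S = Sublist.lookup candidates⊆S r∈T
      T′ : List (Fin n)
      T′ = filter (∁? (spoils? r R)) T
      spoiled : count (spoils? r R) T ≤ waste
      spoiled = count-spoils-≤ R<s candidates-unique candidates⊆S r∈S chosen⊆S few
      ∈T′⁻ : ∀ {u} → u ∈ T′ → u ∈ T × ¬ Spoils r R u
      ∈T′⁻ = ∈-filter⁻ (∁? (spoils? r R)) {xs = T}

    greedy : ∀ m → Partial m → RainbowK c s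
    greedy zero P = rainbowK chosen-unique (trans (sym (+-identityʳ _)) chosen-size) chosen-rainbow
      where open Partial P
    greedy (suc m) P = greedy m (step P)

  -- Shrinking to colour classes

  large-class-or-rainbow : ∀ s D S → Unique S → s * (1 + 2 * (s * s) * D) ≤ length S →
    (Σ (Fin n) λ v → Σ (Fin k) λ a → v ∈ S × D < count (inClass? v a) S) ⊎ RainbowK c s
  large-class-or-rainbow s D S S-unique S-large
    with any? (λ v → Fin.any? (λ a → D <? count (inClass? v a) S)) S
  ... | yes large = let (v , v∈S , a , D<) = find large in inj₁ (v , a , v∈S , D<)
  ... | no ¬large = inj₂ (Greedy.greedy s D S class-small s (Greedy.start s D S class-small S-unique S-large))
    where
    class-small : ∀ {v} a → v ∈ S → count (inClass? v a) S ≤ D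
    class-small {v} a v∈S with D <? count (inClass? v a) S
    ... | yes D< = ⊥-elim (¬large (lose v∈S (a , D<)))
    ... | no D≮ = ≮⇒≥ D≮

  record Invariant (S : List (Fin n)) (L : Fin k → List (Fin n)) : Set where
    field
      S-unique : Unique S
      L-unique : ∀ a → Unique (L a)
      L-mono : ∀ a → IsMonochromatic a (L a)
      L-S-colour : ∀ a {x u} → x ∈ L a → u ∈ S → col c x u ≡ a
      L-disjoint-S : ∀ a {x} → x ∈ L a → x ∉ S

  module _ {S L} (I : Invariant S L) {v} (v∈S : v ∈ S) (a : Fin k) where
    open Invariant I

    ∷-unique : Unique (v ∷ L a)
    ∷-unique = All.tabulate (λ { x∈L refl → L-disjoint-S a x∈L v∈S }) ∷ L-unique a

    ∷-mono : IsMonochromatic a (v ∷ L a)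
    ∷-mono (here refl) (here refl) v≢v = ⊥-elim (v≢v refl)
    ∷-mono {y = y} (here refl) (there y∈L) _ = trans (col-sym c v y) (L-S-colour a y∈L v∈S)
    ∷-mono (there x∈L) (here refl) _ = L-S-colour a x∈L v∈S
    ∷-mono (there x∈L) (there y∈L) x≢y = L-mono a x∈L y∈L x≢y

    invariant-step : Invariant (neighbours v a S) (updateAt L a (v ∷_))
    invariant-step = record
      { S-unique = Unique.filter⁺ (inClass? v a) S-unique
      ; L-unique = updateAt-elim (λ _ K → Unique K) L a (v ∷_) ∷-unique (λ b _ → L-unique b)
      ; L-mono = updateAt-elim IsMonochromatic L a (v ∷_) ∷-mono (λ b _ → L-mono b)
      ; L-S-colour = updateAt-elim (λ b K → ∀ {x u} → x ∈ K → u ∈ S′ → col c x u ≡ b) L a (v ∷_)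
          (λ { (here refl) u∈S′ → proj₂ (proj₂ (∈S′⁻ u∈S′))
             ; (there x∈L) u∈S′ → L-S-colour a x∈L (proj₁ (∈S′⁻ u∈S′)) })
          (λ b _ x∈L u∈S′ → L-S-colour b x∈L (proj₁ (∈S′⁻ u∈S′)))
      ; L-disjoint-S = updateAt-elim (λ b K → ∀ {x} → x ∈ K → x ∉ S′) L a (v ∷_)
          (λ { (here refl) v∈S′ → proj₁ (proj₂ (∈S′⁻ v∈S′)) refl
             ; (there x∈L) x∈S′ → L-disjoint-S a x∈L (proj₁ (∈S′⁻ x∈S′)) })
          (λ b _ x∈L x∈S′ → L-disjoint-S b x∈L (proj₁ (∈S′⁻ x∈S′)))
      }
      where
      S′ : List (Fin n)
      S′ = neighbours v a S
      ∈S′⁻ : ∀ {u} → u ∈ S′ → u ∈ S × InClass v a u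
      ∈S′⁻ = ∈-filter⁻ (inClass? v a) {xs = S}

  module Rounds (s t : ℕ) (2≤s : 2 ≤ s) (1≤k : 1 ≤ k) where

    s^4≢0 : NonZero (s ^ 4)
    s^4≢0 = m^n≢0 s 4 {{>-nonZero (≤-trans (s≤s z≤n) 2≤s)}}

    suc-pred-^ : ∀ e → suc (pred ((s ^ 4) ^ e)) ≡ (s ^ 4) ^ e
    suc-pred-^ e = suc-pred ((s ^ 4) ^ e) {{m^n≢0 (s ^ 4) e {{s^4≢0}}}}

    rainbow-threshold : ∀ e (S : List (Fin n)) → (s ^ 4) ^ suc e ≤ length S →
      s * (1 + 2 * (s * s) * pred ((s ^ 4) ^ e)) ≤ length S
    rainbow-threshold e S S-large = begin
      s * (1 + 2 * (s * s) * pred ((s ^ 4) ^ e)) ≤⟨ rainbow-threshold-≤ (pred ((s ^ 4) ^ e)) 2≤s ⟩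
      s ^ 4 * suc (pred ((s ^ 4) ^ e))           ≡⟨ cong (s ^ 4 *_) (suc-pred-^ e) ⟩
      (s ^ 4) ^ suc e                            ≤⟨ S-large ⟩
      length S ∎
      where open ≤-Reasoning

    rounds : ∀ e S L → Invariant S L → (∀ a → length (L a) < t) → k * t ≤ ∑ (length ∘ L) + e →
      (s ^ 4) ^ e ≤ length S → MonoK c t ⊎ RainbowK c s
    rounds zero S L _ L<t budget _ = ⊥-elim (<-irrefl refl (begin-strict
      ∑ (length ∘ L)      <⟨ m<m+n _ 1≤k ⟩
      ∑ (length ∘ L) + k  ≤⟨ ∑-<-bound (length ∘ L) L<t ⟩
      k * t               ≤⟨ budget ⟩
      ∑ (length ∘ L) + 0  ≡⟨ +-identityʳ _ ⟩
      ∑ (length ∘ L) ∎))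
      where open ≤-Reasoning
    rounds (suc e) S L I L<t budget S-large
      with large-class-or-rainbow s (pred ((s ^ 4) ^ e)) S (Invariant.S-unique I) (rainbow-threshold e S S-large)
    ... | inj₂ rainbow = inj₂ rainbow
    ... | inj₁ (v , a , v∈S , large) with t ≤? length (v ∷ L a)
    ...   | yes t≤ = inj₁ (monoK (∷-unique I v∈S a) t≤ (∷-mono I v∈S a))
    ...   | no t≰ = rounds e (neighbours v a S) (updateAt L a (v ∷_)) (invariant-step I v∈S a)
      (updateAt-elim (λ _ K → length K < t) L a (v ∷_) (≰⇒> t≰) (λ b _ → L<t b))
      (≤-trans budget (≤-reflexive (trans (+-suc _ e) (cong (_+ e) (sym (∑-updateAt-∷ L a v))))))
      (≤-trans (≤-reflexive (sym (suc-pred-^ e))) large)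

initial-invariant : ∀ {N k} (c : Coloring N k) → Invariant c (allFin N) (λ _ → [])
initial-invariant {N} c = record
  { S-unique = Unique.allFin⁺ N ; L-unique = λ _ → [] ; L-mono = λ _ ()
  ; L-S-colour = λ _ () ; L-disjoint-S = λ _ () }

arrows : ∀ {k} t s → 1 ≤ k → 1 ≤ t → 2 ≤ s → Arrows k t s (s ^ (4 * k * t))
arrows {k} t s 1≤k 1≤t 2≤s c =
  Rounds.rounds c s t 2≤s 1≤k (k * t) (allFin N) (λ _ → []) (initial-invariant c) (λ _ → 1≤t)
    (≤-reflexive (sym (cong (_+ k * t) (∑-zero k))))
    (≤-reflexive (begin
      (s ^ 4) ^ (k * t)   ≡⟨ ^-*-assoc s 4 (k * t) ⟩
      s ^ (4 * (k * t))   ≡⟨ cong (s ^_) (sym (*-assoc 4 k t)) ⟩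
      N                   ≡⟨ sym (length-tabulate (λ i → i)) ⟩
      length (allFin N) ∎))
  where
  open ≡-Reasoning
  N : ℕ
  N = s ^ (4 * k * t)

proposition3p1 : (k t s : ℕ) → 1 ≤ k → 1 ≤ t → 1 ≤ s →
  M≤ k t s (s ^ (4 * k * t))
proposition3p1 k t (suc zero) _ _ _ =
  1 , ≤-refl , ≤-reflexive (sym (^-zeroˡ (4 * k * t))) ,
  λ c → inj₂ (rainbowK c ([] ∷ []) refl (singleton-isRainbow c Fin.zero))
proposition3p1 k t s@(suc (suc _)) 1≤k 1≤t _ =
  s ^ (4 * k * t) , m^n>0 s (4 * k * t) , ≤-refl , arrows t s 1≤k 1≤t (s≤s (s≤s z≤n))
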